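{- Let $G:\mathbb{Z}_{>0}\to\mathbb{Z}_{>0}$ be defined by $$G(n)=\begin{cases}5n+1 & \text{if } n=h(n),\\ h(n) & \text{if } n>h(n),\end{cases}\qquad h(n)=2^{v_2(n)}\,3^{v_3(n)}.$$ Then for every positive integer $n$, the sequence $n, G(n), G(G(n)),\dots$ eventually reaches $1$.
   Context: $v_p(n)$ denotes the exponent of the prime $p$ in the factorization of $n$. Thus $h(n)$ is the largest divisor of $n$ whose only prime factors are $2$ and $3$; $G$ either multiplies by $5$ and adds $1$ (when $n$ has no prime factors other than $2,3$), or removes all prime factors other than $2$ and $3$. -}

module Defs where

open import Data.Nat using (ℕ; zero; suc; _+_; _*_; _^_; _/_; _≡ᵇ_)
open import Data.Nat.Divisibility using (_∣?_)
open import Data.Bool using (if_then_else_)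
open import Relation.Nullary.Decidable using (does)

-- Fuel-based: each step divides n by p, so fuel n suffices for n > 0.
-- Convention: the value at n = 0 is 0 (irrelevant: G is only used on n > 0).
valFuel : ℕ → (p : ℕ) → .{{_ : Data.Nat.NonZero p}} → ℕ → ℕ
valFuel zero      p n = 0
valFuel (suc f)   p zero = 0
valFuel (suc f)   p (suc m) =
  if does (p ∣? suc m) then suc (valFuel f p (suc m / p)) else 0

v : (p : ℕ) → .{{_ : Data.Nat.NonZero p}} → ℕ → ℕ
v p n = valFuel n p n

h : ℕ → ℕ
h n = 2 ^ v 2 n * 3 ^ v 3 n

G : ℕ → ℕ
G n = if n ≡ᵇ h n then 5 * n + 1 else h n

iter : ℕ → (ℕ → ℕ) → ℕ → ℕ
iter zero    f x = x
iter (suc k) f x = f (iter k f x)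

module Submission where

-- If n is not 3-smooth, its cofactor n / h(n) is prime to 6, hence at
-- least 5, so G(n) = h(n) < n. If n is 3-smooth, then 5n + 1 is coprime to n; for it to be
-- 3-smooth as well, one of n, 5n + 1 must be a power of 2 and the other a power of 3, which
-- congruences modulo 1312 and 63 exclude once n ≥ 17. So the cofactor of 5n + 1 is at least 5
-- and G(G(n)) = h(5n + 1) < n. The values below 17 are checked by evaluation.

open import Defs
open import Data.Nat
open import Data.Nat.Properties
open import Data.Nat.Divisibility
open import Data.Nat.DivMod
open import Data.Nat.Coprimality using (Coprime; coprime-divisor)
open import Data.Nat.Primality using (Prime; prime[2]; ¬prime[1]; euclidsLemma; prime⇒irreducible)
open import Data.Nat.Induction using (<-rec)
open import Data.Bool using (true; false; T)
open import Data.List using (List; map; upTo)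
open import Data.List.Relation.Unary.All using (All; lookup; all?)
open import Data.List.Relation.Unary.Any using (here)
open import Data.List.Membership.Propositional using (_∈_; _∉_)
open import Data.List.Membership.DecPropositional _≟_ using (_∈?_; _∉?_)
open import Data.Product using (∃; _×_; _,_)
open import Data.Sum using (_⊎_; inj₁; inj₂; [_,_]′)
open import Relation.Nullary using (Dec; contradiction)
open import Relation.Nullary.Decidable using (toWitness; yes; no)
open import Relation.Binary.PropositionalEquality
open import Algebra.Properties.CommutativeSemigroup *-commutativeSemigroup using (x∙yz≈y∙xz)

valFuel-factorisation : ∀ {p} .{{_ : NonZero p}} f {n} → 1 < p → 0 < n → n ≤ f →
                        ∃ λ q → n ≡ p ^ valFuel f p n * q × p ∤ q
valFuel-factorisation {p} (suc f) {suc m} 1<p _ (s≤s m≤f) with p ∣? suc m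
... | no p∤n = suc m , sym (*-identityˡ (suc m)) , p∤n
... | yes p∣n with valFuel-factorisation f 1<p (m≥n⇒m/n>0 (∣⇒≤ p∣n))
                     (≤-trans (≤-pred (m/n<m (suc m) p 1<p)) m≤f)
...   | q , n/p≡ , p∤q = q , n≡ , p∤q
  where
  open ≡-Reasoning
  n≡ : suc m ≡ p * p ^ valFuel f p (suc m / p) * q
  n≡ = begin
    suc m                               ≡⟨ m*[n/m]≡n p∣n ⟨
    p * (suc m / p)                     ≡⟨ cong (p *_) n/p≡ ⟩
    p * (p ^ valFuel f p (suc m / p) * q) ≡⟨ *-assoc p _ q ⟨
    p * p ^ valFuel f p (suc m / p) * q ∎

v-factorisation : ∀ p .{{_ : NonZero p}} {n} → 1 < p → 0 < n →
                  ∃ λ q → n ≡ p ^ v p n * q × p ∤ q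
v-factorisation p {n} 1<p 0<n = valFuel-factorisation n 1<p 0<n ≤-refl

prime∤⇒prime∤^ : ∀ {p m} k → Prime p → p ∤ m → p ∤ m ^ k
prime∤⇒prime∤^ zero    pp _   p∣1   = ¬prime[1] (subst Prime (∣1⇒≡1 p∣1) pp)
prime∤⇒prime∤^ (suc k) pp p∤m p∣m^k =
  [ p∤m , prime∤⇒prime∤^ k pp p∤m ]′ (euclidsLemma _ _ pp p∣m^k)

prime∤⇒coprime : ∀ {p m} → Prime p → p ∤ m → Coprime m p
prime∤⇒coprime pp p∤m (d∣m , d∣p) with prime⇒irreducible pp d∣p
... | inj₁ d≡1 = d≡1
... | inj₂ refl = contradiction d∣m p∤m

coprime-divisor-^ : ∀ {m n o} k → Coprime m n → m ∣ n ^ k * o → m ∣ o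
coprime-divisor-^ {m} {o = o} zero    _   m∣ = subst (m ∣_) (*-identityˡ o) m∣
coprime-divisor-^ {m} {n} {o} (suc k) m⊥n m∣ =
  coprime-divisor-^ k m⊥n (coprime-divisor m⊥n (subst (m ∣_) (*-assoc n (n ^ k) o) m∣))

2∤3 : 2 ∤ 3
2∤3 (divides (suc (suc _)) ())

h-factorisation : ∀ {n} → 0 < n → ∃ λ r → n ≡ h n * r × 2 ∤ r × 3 ∤ r
h-factorisation {n} 0<n
  with v-factorisation 2 (s≤s (s≤s z≤n)) 0<n | v-factorisation 3 (s≤s (s≤s z≤n)) 0<n
... | q₂ , n≡2^a*q₂ , 2∤q₂ | q₃ , n≡3^b*q₃ , 3∤q₃ = r , n≡h*r , 2∤r , 3∤r
  where
  a = v 2 n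
  b = v 3 n
  3^b∣q₂ : 3 ^ b ∣ q₂
  3^b∣q₂ = coprime-divisor-^ a (prime∤⇒coprime prime[2] (prime∤⇒prime∤^ b prime[2] 2∤3))
             (subst (3 ^ b ∣_) (trans (sym n≡3^b*q₃) n≡2^a*q₂) (m∣m*n q₃))
  r = quotient 3^b∣q₂
  q₂≡3^b*r : q₂ ≡ 3 ^ b * r
  q₂≡3^b*r = m∣n⇒n≡m*quotient 3^b∣q₂
  n≡h*r : n ≡ h n * r
  n≡h*r = trans n≡2^a*q₂ (trans (cong (2 ^ a *_) q₂≡3^b*r) (sym (*-assoc (2 ^ a) (3 ^ b) r)))
  2∤r : 2 ∤ r
  2∤r 2∣r = 2∤q₂ (subst (2 ∣_) (sym q₂≡3^b*r) (∣n⇒∣m*n (3 ^ b) 2∣r))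
  q₃≡2^a*r : q₃ ≡ 2 ^ a * r
  q₃≡2^a*r = *-cancelˡ-≡ q₃ (2 ^ a * r) (3 ^ b) {{m^n≢0 3 b}} (begin
    3 ^ b * q₃        ≡⟨ n≡3^b*q₃ ⟨
    n                 ≡⟨ n≡2^a*q₂ ⟩
    2 ^ a * q₂        ≡⟨ cong (2 ^ a *_) q₂≡3^b*r ⟩
    2 ^ a * (3 ^ b * r) ≡⟨ x∙yz≈y∙xz (2 ^ a) (3 ^ b) r ⟩
    3 ^ b * (2 ^ a * r) ∎)
    where open ≡-Reasoning
  3∤r : 3 ∤ r
  3∤r 3∣r = 3∤q₃ (subst (3 ∣_) (sym q₃≡2^a*r) (∣n⇒∣m*n (2 ^ a) 3∣r))

2∤∧3∤⇒≡1⊎5≤ : ∀ {r} → 2 ∤ r → 3 ∤ r → r ≡ 1 ⊎ 5 ≤ r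
2∤∧3∤⇒≡1⊎5≤ {0} 2∤0 _   = contradiction (2 ∣0) 2∤0
2∤∧3∤⇒≡1⊎5≤ {1} _   _   = inj₁ refl
2∤∧3∤⇒≡1⊎5≤ {2} 2∤2 _   = contradiction ∣-refl 2∤2
2∤∧3∤⇒≡1⊎5≤ {3} _   3∤3 = contradiction ∣-refl 3∤3
2∤∧3∤⇒≡1⊎5≤ {4} 2∤4 _   = contradiction (divides 2 refl) 2∤4
2∤∧3∤⇒≡1⊎5≤ {suc (suc (suc (suc (suc r))))} _ _ = inj₂ (m≤m+n 5 r)

h-nonZero : ∀ n → NonZero (h n)
h-nonZero n = m*n≢0 (2 ^ v 2 n) (3 ^ v 3 n) {{m^n≢0 2 (v 2 n)}} {{m^n≢0 3 (v 3 n)}}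

h-pos : ∀ n → 0 < h n
h-pos n = >-nonZero⁻¹ (h n) {{h-nonZero n}}

h-cofactor≥5 : ∀ {n} → 0 < n → n ≢ h n → ∃ λ r → 5 ≤ r × n ≡ h n * r
h-cofactor≥5 0<n n≢hn with h-factorisation 0<n
... | r , n≡hr , 2∤r , 3∤r with 2∤∧3∤⇒≡1⊎5≤ 2∤r 3∤r
...   | inj₁ refl = contradiction (trans n≡hr (*-identityʳ _)) n≢hn
...   | inj₂ 5≤r  = r , 5≤r , n≡hr

cofactor≥5⇒< : ∀ {m n} → 0 < m → (∃ λ r → 5 ≤ r × n ≡ m * r) → m < n
cofactor≥5⇒< {m} 0<m (r , 5≤r , n≡m*r) =
  subst (m <_) (sym n≡m*r) (m<m*n m r {{>-nonZero 0<m}} (≤-trans (s≤s (s≤s z≤n)) 5≤r))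

p∣p^[1+a]*m : ∀ p a m → p ∣ p ^ suc a * m
p∣p^[1+a]*m p a m = ∣m⇒∣m*n m (m∣m*n (p ^ a))

p∣m*p^[1+a] : ∀ p a m → p ∣ m * p ^ suc a
p∣m*p^[1+a] p a m = ∣n⇒∣m*n m (m∣m*n (p ^ a))

∣n∧∣kn+1⇒≡1 : ∀ {d n} k → d ∣ n → d ∣ k * n + 1 → d ≡ 1
∣n∧∣kn+1⇒≡1 k d∣n d∣kn+1 = ∣1⇒≡1 (∣m+n∣m⇒∣n d∣kn+1 (∣n⇒∣m*n k d∣n))

cofactor≥5-of-5n+1⇒< : ∀ {n m} → 1 < n → (∃ λ r → 5 ≤ r × 5 * n + 1 ≡ m * r) → m < n
cofactor≥5-of-5n+1⇒< {n} {m} 1<n (r , 5≤r , eq) = ≤∧≢⇒< m≤n m≢n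
  where
  open ≤-Reasoning
  m≤n : m ≤ n
  m≤n = ≤-pred (*-cancelˡ-< 5 m (suc n) (begin-strict
    5 * m      ≤⟨ *-monoˡ-≤ m 5≤r ⟩
    r * m      ≡⟨ *-comm r m ⟩
    m * r      ≡⟨ eq ⟨
    5 * n + 1  ≡⟨ +-comm (5 * n) 1 ⟩
    1 + 5 * n  <⟨ +-monoˡ-< (5 * n) {1} {5} (s≤s (s≤s z≤n)) ⟩
    5 + 5 * n  ≡⟨ *-suc 5 n ⟨
    5 * suc n  ∎))
  m≢n : m ≢ n
  m≢n refl = <⇒≢ 1<n (sym (∣n∧∣kn+1⇒≡1 5 ∣-refl (divides r (trans eq (*-comm m r)))))

module _ (M : ℕ) .{{_ : NonZero M}} where

  *-%-absorbʳ : ∀ m n → m * (n % M) % M ≡ m * n % M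
  *-%-absorbʳ m n = begin
    m * (n % M) % M           ≡⟨ %-distribˡ-* m (n % M) M ⟩
    m % M * (n % M % M) % M   ≡⟨ cong (λ k → m % M * k % M) (m%n%n≡m%n n M) ⟩
    m % M * (n % M) % M       ≡⟨ %-distribˡ-* m n M ⟨
    m * n % M                 ∎
    where open ≡-Reasoning

  suc-%-absorb : ∀ n → suc (n % M) % M ≡ suc n % M
  suc-%-absorb n = begin
    (1 + n % M) % M           ≡⟨ %-distribˡ-+ 1 (n % M) M ⟩
    (1 % M + n % M % M) % M   ≡⟨ cong (λ k → (1 % M + k) % M) (m%n%n≡m%n n M) ⟩
    (1 % M + n % M) % M       ≡⟨ %-distribˡ-+ 1 n M ⟨
    (1 + n) % M               ∎
    where open ≡-Reasoning

  orbit : ℕ → ℕ → ℕ → List ℕ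
  orbit g c period = map (λ k → c * g ^ k % M) (upTo period)

  OrbitClosed : ℕ → ℕ → ℕ → Set
  OrbitClosed g c period = All (λ r → g * r % M ∈ orbit g c period) (orbit g c period)

  orbitClosed? : ∀ g c period → Dec (OrbitClosed g c period)
  orbitClosed? g c period = all? (λ r → g * r % M ∈? orbit g c period) (orbit g c period)

  c*g^k%M∈orbit : ∀ g c {period} → OrbitClosed g c (suc period) →
                  ∀ k → c * g ^ k % M ∈ orbit g c (suc period)
  c*g^k%M∈orbit g c _      zero    = here refl
  c*g^k%M∈orbit g c closed (suc k) =
    subst (_∈ _) residue (lookup closed (c*g^k%M∈orbit g c closed k))
    where
    residue : g * (c * g ^ k % M) % M ≡ c * g ^ suc k % M
    residue = trans (*-%-absorbʳ g (c * g ^ k)) (cong (_% M) (x∙yz≈y∙xz g c (g ^ k)))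

  ≢suc-by-residues : ∀ {x y} {Rx Ry : List ℕ} → x % M ∈ Rx → y % M ∈ Ry →
                     All (λ r → suc r % M ∉ Rx) Ry → x ≢ suc y
  ≢suc-by-residues {y = y} x∈Rx y∈Ry disjoint refl =
    lookup disjoint y∈Ry (subst (_∈ _) (sym (suc-%-absorb y)) x∈Rx)

-- Modulo 1312 = 2⁵·41 the powers of 3 have period 8 and 160·2^a has period 20; modulo 63 the
-- powers of 2 and 135·3^b both have period 6.
3^y≢1+160*2^a : ∀ a y → 3 ^ y ≢ 1 + 160 * 2 ^ a
3^y≢1+160*2^a a y = ≢suc-by-residues 1312
  (subst (λ x → x % 1312 ∈ _) (*-identityˡ (3 ^ y))
    (c*g^k%M∈orbit 1312 3 1 (toWitness {a? = orbitClosed? 1312 3 1 8} _) y))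
  (c*g^k%M∈orbit 1312 2 160 (toWitness {a? = orbitClosed? 1312 2 160 20} _) a)
  (toWitness {a? = all? (λ r → suc r % 1312 ∉? orbit 1312 3 1 8) (orbit 1312 2 160 20)} _)

2^x≢1+135*3^b : ∀ b x → 2 ^ x ≢ 1 + 135 * 3 ^ b
2^x≢1+135*3^b b x = ≢suc-by-residues 63
  (subst (λ y → y % 63 ∈ _) (*-identityˡ (2 ^ x))
    (c*g^k%M∈orbit 63 2 1 (toWitness {a? = orbitClosed? 63 2 1 6} _) x))
  (c*g^k%M∈orbit 63 3 135 (toWitness {a? = orbitClosed? 63 3 135 6} _) b)
  (toWitness {a? = all? (λ r → suc r % 63 ∉? orbit 63 2 1 6) (orbit 63 3 135 6)} _)

^-cancelʳ-< : ∀ m .{{_ : NonZero m}} {e a} → m ^ e < m ^ a → e < a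
^-cancelʳ-< m m^e<m^a = ≰⇒> (λ a≤e → <⇒≱ m^e<m^a (^-monoʳ-≤ m a≤e))

5*p^a+1≡1+5*p^e*p^[a∸e] : ∀ p {e a} → e ≤ a → 5 * p ^ a + 1 ≡ 1 + 5 * p ^ e * p ^ (a ∸ e)
5*p^a+1≡1+5*p^e*p^[a∸e] p {e} {a} e≤a = begin
  5 * p ^ a + 1                  ≡⟨ +-comm (5 * p ^ a) 1 ⟩
  1 + 5 * p ^ a                  ≡⟨ cong (λ k → 1 + 5 * p ^ k) (m+[n∸m]≡n e≤a) ⟨
  1 + 5 * p ^ (e + (a ∸ e))      ≡⟨ cong (λ k → 1 + 5 * k) (^-distribˡ-+-* p e (a ∸ e)) ⟩
  1 + 5 * (p ^ e * p ^ (a ∸ e))  ≡⟨ cong (1 +_) (*-assoc 5 (p ^ e) (p ^ (a ∸ e))) ⟨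
  1 + 5 * p ^ e * p ^ (a ∸ e)    ∎
  where open ≡-Reasoning

5*2^a+1≢3^y : ∀ {a y} → 17 ≤ 2 ^ a → 5 * 2 ^ a + 1 ≢ 3 ^ y
5*2^a+1≢3^y {a} {y} 17≤2^a eq =
  3^y≢1+160*2^a (a ∸ 5) y
    (trans (sym eq) (5*p^a+1≡1+5*p^e*p^[a∸e] 2 {5} {a} (^-cancelʳ-< 2 {4} 17≤2^a)))

5*3^b+1≢2^x : ∀ {b x} → 17 ≤ 3 ^ b → 5 * 3 ^ b + 1 ≢ 2 ^ x
5*3^b+1≢2^x {b} {x} 17≤3^b eq =
  2^x≢1+135*3^b (b ∸ 3) x
    (trans (sym eq) (5*p^a+1≡1+5*p^e*p^[a∸e] 3 {3} {b} (^-cancelʳ-< 3 {2} 9<3^b)))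
  where 9<3^b = ≤-trans (m≤m+n 10 7) 17≤3^b

-- The bound 17 excludes the genuine solutions 5·16 + 1 = 3⁴ and 5·3 + 1 = 2⁴.
5*smooth+1≢smooth : ∀ a b x y → 17 ≤ 2 ^ a * 3 ^ b → 5 * (2 ^ a * 3 ^ b) + 1 ≢ 2 ^ x * 3 ^ y
5*smooth+1≢smooth (suc a) b (suc x) y _ eq =
  contradiction (∣n∧∣kn+1⇒≡1 5 (p∣p^[1+a]*m 2 a (3 ^ b))
                              (subst (2 ∣_) (sym eq) (p∣p^[1+a]*m 2 x (3 ^ y)))) λ ()
5*smooth+1≢smooth a (suc b) x (suc y) _ eq =
  contradiction (∣n∧∣kn+1⇒≡1 5 (p∣m*p^[1+a] 3 b (2 ^ a))
                              (subst (3 ∣_) (sym eq) (p∣m*p^[1+a] 3 y (2 ^ x)))) λ ()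
5*smooth+1≢smooth a b zero zero 17≤n eq =
  contradiction (subst (17 ≤_) eq (≤-trans 17≤n (≤-trans (m≤n*m _ 5) (m≤m+n _ 1)))) λ { (s≤s ()) }
5*smooth+1≢smooth zero zero x y (s≤s ()) _
5*smooth+1≢smooth (suc a) zero zero (suc y) 17≤n eq =
  5*2^a+1≢3^y {suc a} {suc y} (subst (17 ≤_) 2^a*1≡2^a 17≤n)
    (trans (cong (λ k → 5 * k + 1) (sym 2^a*1≡2^a)) (trans eq (*-identityˡ (3 ^ suc y))))
  where 2^a*1≡2^a = *-identityʳ (2 ^ suc a)
5*smooth+1≢smooth zero (suc b) (suc x) zero 17≤n eq =
  5*3^b+1≢2^x {suc b} {suc x} (subst (17 ≤_) 1*3^b≡3^b 17≤n)
    (trans (cong (λ k → 5 * k + 1) (sym 1*3^b≡3^b)) (trans eq (*-identityʳ (2 ^ suc x))))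
  where 1*3^b≡3^b = *-identityˡ (3 ^ suc b)

Reaches : (ℕ → ℕ) → ℕ → ℕ → Set
Reaches f x y = ∃ λ k → iter k f x ≡ y

iter-suc : ∀ k (f : ℕ → ℕ) x → iter k f (f x) ≡ iter (suc k) f x
iter-suc zero    f x = refl
iter-suc (suc k) f x = cong f (iter-suc k f x)

reaches-via : ∀ {f x x′ y} → f x ≡ x′ → Reaches f x′ y → Reaches f x y
reaches-via {f} {x} refl (k , fᵏx′≡y) = suc k , trans (sym (iter-suc k f x)) fᵏx′≡y

G-smooth : ∀ {n} → n ≡ h n → G n ≡ 5 * n + 1
G-smooth {n} n≡hn with n ≡ᵇ h n | ≡⇒≡ᵇ n (h n) n≡hn
... | true | _ = refl

G-rough : ∀ {n} → n ≢ h n → G n ≡ h n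
G-rough {n} n≢hn with n ≡ᵇ h n in eq
... | true  = contradiction (≡ᵇ⇒≡ n (h n) (subst T (sym eq) _)) n≢hn
... | false = refl

small-reaches-1 : ∀ {n} → n < 17 → 0 < n → Reaches G n 1
small-reaches-1 {1}  _ _ = 0 , refl
small-reaches-1 {2}  _ _ = 2 , refl
small-reaches-1 {3}  _ _ = 6 , refl
small-reaches-1 {4}  _ _ = 8 , refl
small-reaches-1 {5}  _ _ = 1 , refl
small-reaches-1 {6}  _ _ = 2 , refl
small-reaches-1 {7}  _ _ = 1 , refl
small-reaches-1 {8}  _ _ = 2 , refl
small-reaches-1 {9}  _ _ = 4 , refl
small-reaches-1 {10} _ _ = 3 , refl
small-reaches-1 {11} _ _ = 1 , refl
small-reaches-1 {12} _ _ = 2 , refl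
small-reaches-1 {13} _ _ = 1 , refl
small-reaches-1 {14} _ _ = 3 , refl
small-reaches-1 {15} _ _ = 7 , refl
small-reaches-1 {16} _ _ = 5 , refl
small-reaches-1 {suc (suc (suc (suc (suc (suc (suc (suc (suc (suc (suc (suc (suc (suc (suc (suc (suc k))))))))))))))))}
                n<17 _ =
  contradiction n<17 (≤⇒≯ (m≤m+n 17 k))

smooth-descent : ∀ {n} → 17 ≤ n → n ≡ h n → 5 * n + 1 ≢ h (5 * n + 1) × h (5 * n + 1) < n
smooth-descent {n} 17≤n n≡hn = t≢ht , ht<n
  where
  t = 5 * n + 1
  t≢ht : t ≢ h t
  t≢ht t≡ht = 5*smooth+1≢smooth (v 2 n) (v 3 n) (v 2 t) (v 3 t) (subst (17 ≤_) n≡hn 17≤n)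
    (trans (cong (λ m → 5 * m + 1) (sym n≡hn)) t≡ht)
  ht<n : h t < n
  ht<n = cofactor≥5-of-5n+1⇒< {n} {h t} (≤-trans (m≤m+n 2 15) 17≤n)
                                        (h-cofactor≥5 {t} (m≤n+m 1 (5 * n)) t≢ht)

theorem4p6 : (n : ℕ) → n > 0 → ∃ λ k → iter k G n ≡ 1
theorem4p6 = <-rec (λ n → 0 < n → Reaches G n 1) step
  where
  step : ∀ n → (∀ {m} → m < n → 0 < m → Reaches G m 1) → 0 < n → Reaches G n 1
  step n IH 0<n with n <? 17 | n ≟ h n
  ... | yes n<17 | _        = small-reaches-1 n<17 0<n
  ... | no _     | no n≢hn  =
    let hn<n = cofactor≥5⇒< (h-pos n) (h-cofactor≥5 0<n n≢hn) in
    reaches-via {G} {n} (G-rough n≢hn) (IH hn<n (h-pos n))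
  ... | no n≮17  | yes n≡hn =
    let t = 5 * n + 1 ; (t≢ht , ht<n) = smooth-descent (≮⇒≥ n≮17) n≡hn in
    reaches-via {G} {n} (G-smooth n≡hn) (reaches-via {G} {t} (G-rough t≢ht) (IH ht<n (h-pos t)))
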